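{- Let $\mathcal{G} = (V, E_1,\dots,E_\ell)$ be a temporal graph, $s,z\in V$ two distinct vertices with $\{s,z\}\notin E_t$ for all $t\in[\ell]$, $\Delta\le\ell$, and $D=(V',E')$ the $\Delta$-$(s,z)$-expansion of $\mathcal{G}$. Then there is a $\Delta$-restless temporal $(s,z)$-path in $\mathcal{G}$ of length $k$ if and only if there is a directed $(s,z)$-path $P'$ in $D$ of length $k$ such that $|V'(v)\cap V(P')|\le 1$ for all $v\in V$.
   Context: A temporal graph is a tuple $\mathcal{G} = (V, E_1, \dots, E_\ell)$ with $E_i \subseteq \binom{V}{2}$. A temporal $(s,z)$-path of length $k$ is a sequence $((v_{i-1}, v_i, t_i))_{i=1}^k$ with $v_0=s$, $v_k=z$, $\{v_{i-1}, v_i\} \in E_{t_i}$, $t_i \le t_{i+1}$, and pairwise distinct $v_0,\dots,v_k$; it is $\Delta$-restless if $t_i \le t_{i+1} \le t_i + \Delta$ for all $i \in [k-1]$. The $\Delta$-$(s,z)$-expansion of $\mathcal{G}$ is the digraph $D=(V',E')$ with $V' := \{s,z\}\cup\{v^t \mid v\in e, e\in E_t, v\notin\{s,z\}\}$ (a new vertex $v^t$ per pair $(v,t)$), $E_s := \{(s,v^t) \mid \{s,v\}\in E_t\}$, $E_z := \{(v^i,z) \mid v^i\in V', \{v,z\}\in E_t, 0\le t-i\le\Delta\}$, and $E' := E_s\cup E_z\cup\{(v^i,w^t)\mid v^i\in V'\setminus\{s,z\}, \{v,w\}\in E_t, 0\le t-i\le\Delta\}$. Moreover $V'(s):=\{s\}$,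 $V'(z):=\{z\}$, and $V'(v):=\{v^t\in V'\mid t\in[\ell]\}$ for $v\in V\setminus\{s,z\}$. The length of a directed path is its number of arcs. -}

module Defs where

open import Data.Nat using (ℕ; zero; suc; _+_; _≤_)
open import Data.Fin using (Fin; zero; suc; toℕ; fromℕ; inject₁)
open import Data.Bool using (Bool; true)
open import Data.Unit using (⊤)
open import Data.Product using (_×_; Σ; ∃; ∃-syntax; _,_)
open import Data.Sum using (_⊎_)
open import Relation.Binary.PropositionalEquality using (_≡_; _≢_)
open import Function.Definitions using (Injective)

-- Time step t ∈ [ℓ]
-- is represented by t : Fin ℓ (i.e. shifted by one; only differences and
-- order of time steps matter).  E t is an arbitrary relation whose
-- symmetrisation restricted to distinct vertices is the edge set E_t.
record TemporalGraph : Set where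
  field
    n : ℕ
    ℓ : ℕ
    E : Fin ℓ → Fin n → Fin n → Bool

module _ (G : TemporalGraph) where
  open TemporalGraph G

  Edge : Fin ℓ → Fin n → Fin n → Set
  Edge t u v = u ≢ v × (E t u v ≡ true ⊎ E t v u ≡ true)

  -- A Δ-restless temporal (s,z)-path of length k: vertices v_0..v_k
  -- (vs : Fin (suc k) → V) and time labels t_1..t_k (ts : Fin k → Fin ℓ).
  record RestlessPath (Δ : ℕ) (s z : Fin n) (k : ℕ) : Set where
    field
      vs       : Fin (suc k) → Fin n
      ts       : Fin k → Fin ℓ
      start    : vs zero ≡ s
      end      : vs (fromℕ k) ≡ z
      edges    : (i : Fin k) → Edge (ts i) (vs (inject₁ i)) (vs (suc i))
      distinct : Injective _≡_ _≡_ vs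
      restless : (i j : Fin k) → toℕ j ≡ suc (toℕ i) →
                 (toℕ (ts i) ≤ toℕ (ts j)) × (toℕ (ts j) ≤ toℕ (ts i) + Δ)

  -- Candidate vertices of the expansion: s, z, and copies v^t.
  data DV : Set where
    src : DV
    snk : DV
    cp  : Fin n → Fin ℓ → DV

  Window : ℕ → Fin ℓ → Fin ℓ → Set
  Window Δ i t = (toℕ i ≤ toℕ t) × (toℕ t ≤ toℕ i + Δ)

  module Expansion (Δ : ℕ) (s z : Fin n) where

    InV' : DV → Set
    InV' src = ⊤
    InV' snk = ⊤
    InV' (cp v t) = v ≢ s × v ≢ z × ∃[ w ] Edge t v w

    data Arc : DV → DV → Set where
      arc-s : ∀ {v t} → InV' (cp v t) → Edge t s v → Arc src (cp v t)
      arc-z : ∀ {v i t} → InV' (cp v i) → Edge t v z → Window Δ i t →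
              Arc (cp v i) snk
      arc-m : ∀ {v w i t} → InV' (cp v i) → InV' (cp w t) → Edge t v w →
              Window Δ i t → Arc (cp v i) (cp w t)

    owner : DV → Fin n
    owner src = s
    owner snk = z
    owner (cp v _) = v

    InV'of : Fin n → DV → Set
    InV'of v x = InV' x × owner x ≡ v

    record DPath (k : ℕ) : Set where
      field
        ps       : Fin (suc k) → DV
        inD      : (i : Fin (suc k)) → InV' (ps i)
        start    : ps zero ≡ src
        end      : ps (fromℕ k) ≡ snk
        arcs     : (i : Fin k) → Arc (ps (inject₁ i)) (ps (suc i))
        distinct : Injective _≡_ _≡_ ps

    AtMostOnePerVertex : ∀ {k : ℕ} → DPath k → Set
    AtMostOnePerVertex {k} P = (v : Fin n) (i j : Fin (suc k)) →
      InV'of v (ps i) → InV'of v (ps j) → ps i ≡ ps j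
      where open DPath P

module Submission where

open import Defs
open import Data.Nat using (ℕ; _≤_; zero; suc)
open import Data.Fin using (Fin; zero; suc; toℕ; fromℕ; inject₁; _≟_)
open import Data.Fin.Properties using (toℕ-injective; toℕ-inject₁; fromℕ≢inject₁; 0≢1+n)
open import Data.Product using (Σ; _,_; proj₁)
open import Data.Sum using (inj₁; inj₂)
open import Data.Empty using (⊥-elim)
open import Data.Unit using (tt)
open import Relation.Binary.PropositionalEquality using (_≢_; _≡_; refl; sym; trans; cong; subst)
open import Relation.Nullary using (¬_; yes; no)
open import Function.Bundles using (_⇔_; mk⇔)

-- A restless path s = v₀, …, v_k = z with labels t₁, …, t_k corresponds to the
-- path s, v₁^{t₁}, …, v_{k-1}^{t_{k-1}}, z in the expansion: an arc v^i → w^t of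
-- the expansion is exactly an edge {v, w} ∈ E_t taken at most Δ steps after i,
-- which is the restless condition between consecutive labels.  Conversely,
-- projecting a path of the expansion to the owners of its vertices gives a
-- temporal walk whose labels are the times of the arcs; it visits no vertex
-- twice precisely because it meets each V'(v) at most once.

module _ (G : TemporalGraph) where
  open TemporalGraph G

  Edge-sym : ∀ {t u v} → Edge G t u v → Edge G t v u
  Edge-sym (u≢v , inj₁ e) = (λ v≡u → u≢v (sym v≡u)) , inj₂ e
  Edge-sym (u≢v , inj₂ e) = (λ v≡u → u≢v (sym v≡u)) , inj₁ e

  module _ (Δ : ℕ) (s z : Fin n) where
    open Expansion G Δ s z

    arc-time : ∀ {x y} → Arc x y → Fin ℓ
    arc-time (arc-s {t = t} _ _)     = t
    arc-time (arc-z {t = t} _ _ _)   = t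
    arc-time (arc-m {t = t} _ _ _ _) = t

    arc-edge : ∀ {x y} (a : Arc x y) → Edge G (arc-time a) (owner x) (owner y)
    arc-edge (arc-s _ e)     = e
    arc-edge (arc-z _ e _)   = e
    arc-edge (arc-m _ _ e _) = e

    consecutive-arcs-window : ∀ {x y y′ w} (a : Arc x y) (b : Arc y′ w) → y ≡ y′ →
                              Window G Δ (arc-time a) (arc-time b)
    consecutive-arcs-window (arc-s _ _)     (arc-z _ _ w)   refl = w
    consecutive-arcs-window (arc-s _ _)     (arc-m _ _ _ w) refl = w
    consecutive-arcs-window (arc-m _ _ _ _) (arc-z _ _ w)   refl = w
    consecutive-arcs-window (arc-m _ _ _ _) (arc-m _ _ _ w) refl = w

    -- z has no copies in V', so the sink plays the role of every copy of z.
    copy : Fin n → Fin ℓ → DV G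
    copy v t with v ≟ z
    ... | yes _ = snk
    ... | no  _ = cp v t

    copy-z : ∀ t → copy z t ≡ snk
    copy-z t with z ≟ z
    ... | yes _   = refl
    ... | no  z≢z = ⊥-elim (z≢z refl)

    owner-copy : ∀ v t → owner (copy v t) ≡ v
    owner-copy v t with v ≟ z
    ... | yes v≡z = sym v≡z
    ... | no  _   = refl

    copy-∈V' : ∀ {v t w} → v ≢ s → Edge G t v w → InV' (copy v t)
    copy-∈V' {v} {t} {w} v≢s e with v ≟ z
    ... | yes _   = tt
    ... | no  v≢z = v≢s , v≢z , w , e

    src-arc-copy : ∀ {w t} → ¬ Edge G t s z → Edge G t s w → Arc src (copy w t)
    src-arc-copy {w} {t} ¬sz e with w ≟ z
    ... | yes refl = ⊥-elim (¬sz e)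
    ... | no  w≢z  = arc-s ((λ w≡s → proj₁ e (sym w≡s)) , w≢z , s , Edge-sym e) e

    copy-arc-copy : ∀ {v w i t u} → v ≢ s → v ≢ z → Edge G i v u →
                    Edge G t v w → w ≢ s → Window G Δ i t →
                    Arc (copy v i) (copy w t)
    copy-arc-copy {v} {w} {i} {t} {u} v≢s v≢z eᵢ e w≢s win with v ≟ z
    ... | yes v≡z = ⊥-elim (v≢z v≡z)
    ... | no  _ with w ≟ z
    ...   | yes refl = arc-z (v≢s , v≢z , u , eᵢ) e win
    ...   | no  w≢z  = arc-m (v≢s , v≢z , u , eᵢ) (w≢s , w≢z , v , Edge-sym e) e win

    lift : ∀ {k} → (Fin (suc k) → Fin n) → (Fin k → Fin ℓ) → Fin (suc k) → DV G
    lift vs ts zero    = src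
    lift vs ts (suc i) = copy (vs (suc i)) (ts i)

    lift-last : ∀ {k} (vs : Fin (suc k) → Fin n) (ts : Fin k → Fin ℓ) → s ≢ z →
                vs zero ≡ s → vs (fromℕ k) ≡ z → lift vs ts (fromℕ k) ≡ snk
    lift-last {zero}  vs ts s≢z start end = ⊥-elim (s≢z (trans (sym start) end))
    lift-last {suc _} vs ts s≢z start end = subst (λ v → copy v _ ≡ snk) (sym end) (copy-z _)

    module FromRestlessPath {k : ℕ} (s≢z : s ≢ z) (¬sz : (t : Fin ℓ) → ¬ Edge G t s z)
                            (R : RestlessPath G Δ s z k) where
      open RestlessPath R

      lifted : Fin (suc k) → DV G
      lifted = lift vs ts

      owner-lift : ∀ i → owner (lifted i) ≡ vs i
      owner-lift zero    = sym start
      owner-lift (suc i) = owner-copy (vs (suc i)) (ts i)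

      lift-injective : ∀ {i j} → lifted i ≡ lifted j → i ≡ j
      lift-injective {i} {j} eq =
        distinct (trans (sym (owner-lift i)) (trans (cong owner eq) (owner-lift j)))

      suc-≢-start : ∀ (i : Fin k) → vs (suc i) ≢ s
      suc-≢-start i eq = 0≢1+n (sym (distinct (trans eq (sym start))))

      inject₁-≢-end : ∀ (i : Fin k) → vs (inject₁ i) ≢ z
      inject₁-≢-end i eq = fromℕ≢inject₁ (distinct (trans end (sym eq)))

      lift-∈V' : ∀ i → InV' (lifted i)
      lift-∈V' zero    = tt
      lift-∈V' (suc i) = copy-∈V' (suc-≢-start i) (Edge-sym (edges i))

      lift-arc : (i : Fin k) → Arc (lifted (inject₁ i)) (lifted (suc i))
      lift-arc zero =
        src-arc-copy (¬sz (ts zero)) (subst (λ v → Edge G (ts zero) v (vs (suc zero))) start (edges zero))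
      lift-arc (suc i) =
        copy-arc-copy (suc-≢-start (inject₁ i)) (inject₁-≢-end (suc i))
                      (Edge-sym (edges (inject₁ i))) (edges (suc i)) (suc-≢-start (suc i))
                      (restless (inject₁ i) (suc i) (cong suc (sym (toℕ-inject₁ i))))

      path : DPath k
      path = record
        { ps = lifted ; inD = lift-∈V' ; start = refl ; end = lift-last vs ts s≢z start end
        ; arcs = lift-arc ; distinct = lift-injective }

      path-at-most-once : AtMostOnePerVertex path
      path-at-most-once v i j (_ , owner-i) (_ , owner-j) =
        cong lifted (distinct (trans (sym (owner-lift i)) (trans owner-i (trans (sym owner-j) (owner-lift j)))))

    project : ∀ {k} (P : DPath k) → AtMostOnePerVertex P → RestlessPath G Δ s z k
    project P at-most-once = record
      { vs       = λ i → owner (ps i)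
      ; ts       = λ i → arc-time (arcs i)
      ; start    = cong owner start
      ; end      = cong owner end
      ; edges    = λ i → arc-edge (arcs i)
      ; distinct = λ {i} {j} eq → distinct (at-most-once (owner (ps j)) i j (inD i , eq) (inD j , refl))
      ; restless = λ i j j≡1+i → consecutive-arcs-window (arcs i) (arcs j)
          (cong ps (toℕ-injective (sym (trans (toℕ-inject₁ j) j≡1+i))))
      }
      where open DPath P

lemma12 : (G : TemporalGraph) (s z : Fin (TemporalGraph.n G)) (Δ k : ℕ) →
    s ≢ z →
    ((t : Fin (TemporalGraph.ℓ G)) → ¬ Edge G t s z) →
    Δ ≤ TemporalGraph.ℓ G →
    RestlessPath G Δ s z k ⇔
      Σ (Expansion.DPath G Δ s z k) (λ P → Expansion.AtMostOnePerVertex G Δ s z P)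
lemma12 G s z Δ k s≢z ¬sz _ = mk⇔
  (λ R → let open FromRestlessPath G Δ s z s≢z ¬sz R in path , path-at-most-once)
  (λ (P , at-most-once) → project G Δ s z P at-most-once)
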